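{- For every positive integer $n$, \[ B(n) \;=\; \frac{n}{2}\left(\lfloor \lg n \rfloor + 1\right) - \sum_{k=0}^{\lfloor \lg n \rfloor} 2^k \, \mathrm{Zigzag}\!\left(\frac{n}{2^{k+1}}\right). \]
   Context: $B$ is the function on positive integers defined by $B(1) = 0$ and, for $n \ge 2$, $B(n) = \lfloor n/2 \rfloor + B(\lfloor n/2 \rfloor) + B(\lceil n/2 \rceil)$; it equals the minimum number of key comparisons performed by top-down MergeSort (splitting into the first $\lfloor n/2\rfloor$ and last $\lceil n/2\rceil$ elements and merging linearly) on an $n$-element array. $\lg$ denotes the logarithm to base 2. For a real number $x$, $\mathrm{Zigzag}(x) = \min\left(x - \lfloor x \rfloor,\ \lceil x \rceil - x\right)$. -}

module Defs where

open import Data.Nat using (ℕ; zero; suc; _+_; _^_; ⌊_/2⌋; ⌈_/2⌉)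
open import Data.Nat.Properties using (m^n≢0)
open import Data.Integer using (+_)
open import Data.Rational using (ℚ; 0ℚ; _/_; _-_; _⊓_; floor; ceiling) renaming (_+_ to _+ℚ_)

-- B with explicit fuel; fuel n is always enough for argument n (each recursive
-- call strictly decreases the argument when n ≥ 2), so B n = Bfuel n n satisfies
-- B 1 = 0 and B n = ⌊n/2⌋ + B ⌊n/2⌋ + B ⌈n/2⌉ for n ≥ 2.
Bfuel : ℕ → ℕ → ℕ
Bfuel zero n = 0
Bfuel (suc f) zero = 0
Bfuel (suc f) (suc zero) = 0
Bfuel (suc f) n@(suc (suc _)) = ⌊ n /2⌋ + Bfuel f ⌊ n /2⌋ + Bfuel f ⌈ n /2⌉

B : ℕ → ℕ
B n = Bfuel n n

ℤtoℚ : _ → ℚ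
ℤtoℚ z = z / 1

Zigzag : ℚ → ℚ
Zigzag x = (x - ℤtoℚ (floor x)) ⊓ (ℤtoℚ (ceiling x) - x)

_/2^_ : ℕ → ℕ → ℚ
n /2^ j = _/_ (+ n) (2 ^ j) {{m^n≢0 2 j}}

sumUpTo : ℕ → (ℕ → ℚ) → ℚ
sumUpTo zero f = f 0
sumUpTo (suc L) f = sumUpTo L f +ℚ f (suc L)

-- Let d k m be the distance from m to the nearest multiple of 2^(k+1), so that
-- 2^k · Zigzag (m / 2^(k+1)) = d k m / 2.  Because 2^(k+2) is a multiple of 4, halving gives
-- d (k+1) m = d k ⌊m/2⌋ + d k ⌈m/2⌉, while d 0 m = ⌈m/2⌉ - ⌊m/2⌋.  Combined with the recurrence
-- for B, strong induction on m yields 2 B(m) + Σ_{k ≤ K} d k m = m (K + 1) whenever m ≤ 2^(K+1),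
-- and K = ⌊lg n⌋ is admissible.  Dividing by 2 gives the rational identity.
module Submission where

open import Defs

module EqualFractions where
  open import Data.Nat
  open import Data.Nat.Properties using (m*n≢0; *-comm)
  open import Data.Nat.DivMod
  open import Relation.Binary.PropositionalEquality
  open ≡-Reasoning

  module _ (b M : ℕ) .{{_ : NonZero b}} .{{_ : NonZero M}} where
    private instance
      b*M≢0 : NonZero (b * M)
      b*M≢0 = m*n≢0 b M
      M*b≢0 : NonZero (M * b)
      M*b≢0 = m*n≢0 M b

    cross-/ : ∀ {a m} → a * M ≡ m * b → a / b ≡ m / M
    cross-/ {a} {m} a*M≡m*b = begin
      a / b           ≡⟨ m*n/o*n≡m/o a M b ⟨
      a * M / (b * M) ≡⟨ /-congˡ {o = b * M} a*M≡m*b ⟩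
      m * b / (b * M) ≡⟨ /-congʳ (*-comm b M) ⟩
      m * b / (M * b) ≡⟨ m*n/o*n≡m/o m b M ⟩
      m / M           ∎

    cross-% : ∀ {a m} → a * M ≡ m * b → a % b * M ≡ m % M * b
    cross-% {a} {m} a*M≡m*b = begin
      a % b * M       ≡⟨ m%n*o≡m*o%[n*o] a b M ⟩
      a * M % (b * M) ≡⟨ %-congˡ {o = b * M} a*M≡m*b ⟩
      m * b % (b * M) ≡⟨ %-congʳ (*-comm b M) ⟩
      m * b % (M * b) ≡⟨ m%n*o≡m*o%[n*o] m M b ⟨
      m % M * b       ∎

module Distance where
  open import Data.Nat
  open import Data.Nat.Properties
  open import Data.Nat.DivMod
  open import Data.Product using (∃; _,_)
  open import Data.Sum using (_⊎_; inj₁; inj₂)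
  open import Relation.Binary.PropositionalEquality
  open import Relation.Binary.Definitions using (tri<; tri≈; tri>)
  open import Relation.Nullary using (contradiction)
  open import Data.Nat.Tactic.RingSolver using (solve-∀)
  open ≡-Reasoning

  2*n≡n+n : ∀ n → 2 * n ≡ n + n
  2*n≡n+n n = cong (n +_) (+-identityʳ n)

  ⌊m+[n+n]/2⌋≡⌊m/2⌋+n : ∀ m n → ⌊ m + (n + n) /2⌋ ≡ ⌊ m /2⌋ + n
  ⌊m+[n+n]/2⌋≡⌊m/2⌋+n zero          n = sym (n≡⌊n+n/2⌋ n)
  ⌊m+[n+n]/2⌋≡⌊m/2⌋+n (suc zero)    n = sym (n≡⌈n+n/2⌉ n)
  ⌊m+[n+n]/2⌋≡⌊m/2⌋+n (suc (suc m)) n = cong suc (⌊m+[n+n]/2⌋≡⌊m/2⌋+n m n)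

  even⊎odd : ∀ n → ∃ λ c → n ≡ c + c ⊎ n ≡ suc (c + c)
  even⊎odd zero = 0 , inj₁ refl
  even⊎odd (suc n) with even⊎odd n
  ... | c , inj₁ refl = c , inj₂ refl
  ... | c , inj₂ refl = suc c , inj₁ (cong suc (sym (+-suc c c)))

  ⊓-double : ∀ a b → (a + a) ⊓ (b + b) ≡ a ⊓ b + a ⊓ b
  ⊓-double a b with ≤-total a b
  ... | inj₁ a≤b rewrite m≤n⇒m⊓n≡m a≤b | m≤n⇒m⊓n≡m (+-mono-≤ a≤b a≤b) = refl
  ... | inj₂ b≤a rewrite m≥n⇒m⊓n≡n b≤a | m≥n⇒m⊓n≡n (+-mono-≤ b≤a b≤a) = refl

  ⊓-double-suc : ∀ a b → a ≢ b → suc (a + a) ⊓ suc (b + b) ≡ a ⊓ suc b + suc a ⊓ b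
  ⊓-double-suc a b a≢b with <-cmp a b
  ... | tri< a<b _ _ rewrite m≤n⇒m⊓n≡m (m≤n⇒m≤1+n (<⇒≤ a<b)) | m≤n⇒m⊓n≡m a<b
                           | m≤n⇒m⊓n≡m (s≤s (+-mono-≤ (<⇒≤ a<b) (<⇒≤ a<b))) | +-suc a a = refl
  ... | tri≈ _ a≡b _ = contradiction a≡b a≢b
  ... | tri> _ _ b<a rewrite m≥n⇒m⊓n≡n b<a | m≥n⇒m⊓n≡n (m≤n⇒m≤1+n (<⇒≤ b<a))
                           | m≥n⇒m⊓n≡n (s≤s (+-mono-≤ (<⇒≤ b<a) (<⇒≤ b<a))) = refl

  tent : ℕ → ℕ → ℕ
  tent x N = x ⊓ (N ∸ x)

  -- The distance from m to the nearest multiple of M, i.e. M · Zigzag (m / M).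
  dist : ℕ → (M : ℕ) → .{{NonZero M}} → ℕ
  dist m M = tent (m % M) M

  dist-periodic : ∀ r q M .{{_ : NonZero M}} → dist (r + q * M) M ≡ dist r M
  dist-periodic r q M = cong (λ x → tent x M) ([m+kn]%n≡m%n r q M)

  dist-≤ : ∀ {r M} .{{_ : NonZero M}} → r ≤ M → dist r M ≡ tent r M
  dist-≤ {r} {M} r≤M with m≤n⇒m<n∨m≡n r≤M
  ... | inj₁ r<M = cong (λ x → tent x M) (m<n⇒m%n≡m r<M)
  ... | inj₂ refl = begin
    tent (r % r) r ≡⟨ cong (λ x → tent x r) (n%n≡0 r) ⟩
    0              ≡⟨ ⊓-zeroʳ r ⟨
    r ⊓ 0          ≡⟨ cong (r ⊓_) (n∸n≡0 r) ⟨
    tent r r       ∎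

  dist-small : ∀ {m M} .{{_ : NonZero M}} → m + m ≤ M → dist m M ≡ m
  dist-small {m} {M} m+m≤M =
    trans (dist-≤ (≤-trans (m≤m+n m m) m+m≤M)) (m≤n⇒m⊓n≡m (m+n≤o⇒m≤o∸n m m+m≤M))

  tent-double : ∀ {c N} → c ≤ N → tent (c + c) (N + N) ≡ tent c N + tent c N
  tent-double {c} c≤N with m≤n⇒∃[o]m+o≡n c≤N
  ... | d , refl = begin
    (c + c) ⊓ ((c + d) + (c + d) ∸ (c + c)) ≡⟨ cong (λ x → (c + c) ⊓ (x ∸ (c + c))) (regroup c d) ⟩
    (c + c) ⊓ ((c + c) + (d + d) ∸ (c + c)) ≡⟨ cong ((c + c) ⊓_) (m+n∸m≡n (c + c) (d + d)) ⟩
    (c + c) ⊓ (d + d)                       ≡⟨ ⊓-double c d ⟩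
    c ⊓ d + c ⊓ d                           ≡⟨ cong (λ x → c ⊓ x + c ⊓ x) (m+n∸m≡n c d) ⟨
    tent c (c + d) + tent c (c + d)         ∎
    where
    regroup : ∀ c d → (c + d) + (c + d) ≡ (c + c) + (d + d)
    regroup = solve-∀

  -- Evenness of N excludes N = 2c + 1, where c and c + 1 would straddle the peak N / 2 of tent · N.
  tent-double-suc : ∀ {c N h} → N ≡ h + h → c < N →
                    tent (suc (c + c)) (N + N) ≡ tent c N + tent (suc c) N
  tent-double-suc {c} {h = h} N≡h+h c<N with m≤n⇒∃[o]m+o≡n c<N
  ... | d , refl = begin
    suc (c + c) ⊓ ((suc c + d) + (suc c + d) ∸ suc (c + c))
      ≡⟨ cong (λ x → suc (c + c) ⊓ (x ∸ suc (c + c))) (regroup c d) ⟩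
    suc (c + c) ⊓ (suc (c + c) + suc (d + d) ∸ suc (c + c))
      ≡⟨ cong (suc (c + c) ⊓_) (m+n∸m≡n (suc (c + c)) (suc (d + d))) ⟩
    suc (c + c) ⊓ suc (d + d)
      ≡⟨ ⊓-double-suc c d c≢d ⟩
    c ⊓ suc d + suc c ⊓ d
      ≡⟨ cong₂ (λ x y → c ⊓ x + suc c ⊓ y) (trans (cong (_∸ c) (sym (+-suc c d))) (m+n∸m≡n c (suc d)))
                                          (m+n∸m≡n (suc c) d) ⟨
    tent c (suc c + d) + tent (suc c) (suc c + d)
      ∎
    where
    regroup : ∀ c d → (suc c + d) + (suc c + d) ≡ suc (c + c) + suc (d + d)
    regroup = solve-∀
    c≢d : c ≢ d
    c≢d refl = even≢odd h c (trans (2*n≡n+n h) (trans (sym N≡h+h) (cong suc (sym (2*n≡n+n c)))))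

  tent-halves : ∀ {h N r} → N ≡ h + h → r ≤ N + N → tent r (N + N) ≡ tent ⌊ r /2⌋ N + tent ⌈ r /2⌉ N
  tent-halves {h} {N} {r} N≡h+h r≤2N with even⊎odd r
  ... | c , inj₁ refl = trans (tent-double c≤N)
                              (cong₂ (λ x y → tent x N + tent y N) (n≡⌊n+n/2⌋ c) (n≡⌈n+n/2⌉ c))
    where
    c≤N : c ≤ N
    c≤N = ≮⇒≥ λ N<c → <⇒≱ (+-mono-< N<c N<c) r≤2N
  ... | c , inj₂ refl = trans (tent-double-suc {h = h} N≡h+h c<N)
                              (cong₂ (λ x y → tent x N + tent y N) (n≡⌈n+n/2⌉ c) (cong suc (n≡⌊n+n/2⌋ c)))
    where
    c<N : c < N
    c<N = ≮⇒≥ λ N≤c → <⇒≱ (s≤s (+-mono-≤ (s≤s⁻¹ N≤c) (s≤s⁻¹ N≤c))) r≤2N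

  dist-halves : ∀ {h N M} .{{_ : NonZero N}} .{{_ : NonZero M}} → N ≡ h + h → M ≡ N + N →
                ∀ m → dist m M ≡ dist ⌊ m /2⌋ N + dist ⌈ m /2⌉ N
  dist-halves {h} {N} N≡h+h refl m = begin
    tent r (N + N)
      ≡⟨ tent-halves {h} N≡h+h r≤2N ⟩
    tent ⌊ r /2⌋ N + tent ⌈ r /2⌉ N
      ≡⟨ cong₂ _+_ (reduce ⌊r/2⌋≤N ⌊m/2⌋≡) (reduce ⌈r/2⌉≤N ⌈m/2⌉≡) ⟨
    dist ⌊ m /2⌋ N + dist ⌈ m /2⌉ N
      ∎
    where
    r q : ℕ
    r = m % (N + N)
    q = m / (N + N)
    r≤2N : r ≤ N + N
    r≤2N = <⇒≤ (m%n<n m (N + N))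
    m≡ : m ≡ r + (q * N + q * N)
    m≡ = trans (m≡m%n+[m/n]*n m (N + N)) (cong (r +_) (*-distribˡ-+ q N N))
    ⌊m/2⌋≡ : ⌊ m /2⌋ ≡ ⌊ r /2⌋ + q * N
    ⌊m/2⌋≡ = trans (cong ⌊_/2⌋ m≡) (⌊m+[n+n]/2⌋≡⌊m/2⌋+n r (q * N))
    ⌈m/2⌉≡ : ⌈ m /2⌉ ≡ ⌈ r /2⌉ + q * N
    ⌈m/2⌉≡ = trans (cong ⌈_/2⌉ m≡) (⌊m+[n+n]/2⌋≡⌊m/2⌋+n (suc r) (q * N))
    ⌈r/2⌉≤N : ⌈ r /2⌉ ≤ N
    ⌈r/2⌉≤N = ≤-trans (⌈n/2⌉-mono r≤2N) (≤-reflexive (sym (n≡⌈n+n/2⌉ N)))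
    ⌊r/2⌋≤N : ⌊ r /2⌋ ≤ N
    ⌊r/2⌋≤N = ≤-trans (⌊n/2⌋≤⌈n/2⌉ r) ⌈r/2⌉≤N
    reduce : ∀ {x y} → x ≤ N → y ≡ x + q * N → dist y N ≡ tent x N
    reduce {x} x≤N refl = trans (dist-periodic x q N) (dist-≤ x≤N)

  dist-2 : ∀ m → dist m 2 + ⌊ m /2⌋ ≡ ⌈ m /2⌉
  dist-2 zero          = refl
  dist-2 (suc zero)    = refl
  dist-2 (suc (suc m)) = trans (+-suc (dist m 2) ⌊ m /2⌋) (cong suc (dist-2 m))

module MergeSortCost where
  open import Data.Nat
  open import Data.Nat.Properties
  open import Data.Nat.Logarithm
  open import Relation.Binary.PropositionalEquality
  open import Data.Nat.Tactic.RingSolver using (solve-∀)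
  open import Algebra.Properties.CommutativeSemigroup +-commutativeSemigroup using (interchange)
  open import Function using (_∘_)
  open ≡-Reasoning
  open Distance using (2*n≡n+n; dist; dist-small; dist-halves; dist-2)

  sumUpToℕ : ℕ → (ℕ → ℕ) → ℕ
  sumUpToℕ zero    f = f 0
  sumUpToℕ (suc K) f = sumUpToℕ K f + f (suc K)

  sumUpToℕ-cong : ∀ K {f g} → (∀ k → f k ≡ g k) → sumUpToℕ K f ≡ sumUpToℕ K g
  sumUpToℕ-cong zero    f≗g = f≗g 0
  sumUpToℕ-cong (suc K) f≗g = cong₂ _+_ (sumUpToℕ-cong K f≗g) (f≗g (suc K))

  sumUpToℕ-suc : ∀ K f → sumUpToℕ (suc K) f ≡ f 0 + sumUpToℕ K (f ∘ suc)
  sumUpToℕ-suc zero    f = refl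
  sumUpToℕ-suc (suc K) f = trans (cong (_+ f (suc (suc K))) (sumUpToℕ-suc K f)) (+-assoc (f 0) _ _)

  sumUpToℕ-+ : ∀ K f g → sumUpToℕ K (λ k → f k + g k) ≡ sumUpToℕ K f + sumUpToℕ K g
  sumUpToℕ-+ zero    f g = refl
  sumUpToℕ-+ (suc K) f g =
    trans (cong (_+ (f (suc K) + g (suc K))) (sumUpToℕ-+ K f g))
          (interchange (sumUpToℕ K f) (sumUpToℕ K g) (f (suc K)) (g (suc K)))

  sumUpToℕ-const : ∀ K c → sumUpToℕ K (λ _ → c) ≡ c * suc K
  sumUpToℕ-const zero    c = sym (*-identityʳ c)
  sumUpToℕ-const (suc K) c =
    trans (cong (_+ c) (sumUpToℕ-const K c)) (trans (+-comm (c * suc K) c) (sym (*-suc c (suc K))))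

  distSum : ℕ → ℕ → ℕ
  distSum K m = sumUpToℕ K (λ k → dist m (2 ^ suc k) {{m^n≢0 2 (suc k)}})

  distSum-small : ∀ {m} K → m + m ≤ 2 → distSum K m ≡ m * suc K
  distSum-small {m} K m+m≤2 = trans (sumUpToℕ-cong K small) (sumUpToℕ-const K m)
    where
    small : ∀ k → dist m (2 ^ suc k) {{m^n≢0 2 (suc k)}} ≡ m
    small k = dist-small {{m^n≢0 2 (suc k)}} (≤-trans m+m≤2 (*-monoʳ-≤ 2 (m^n>0 2 k)))

  distSum-suc : ∀ K m → distSum (suc K) m ≡ dist m 2 + (distSum K ⌊ m /2⌋ + distSum K ⌈ m /2⌉)
  distSum-suc K m = trans (sumUpToℕ-suc K _) (cong (dist m 2 +_)
    (trans (sumUpToℕ-cong K halves) (sumUpToℕ-+ K _ _)))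
    where
    halves : ∀ k → dist m (2 ^ suc (suc k)) {{m^n≢0 2 (suc (suc k))}}
                 ≡ dist ⌊ m /2⌋ (2 ^ suc k) {{m^n≢0 2 (suc k)}} + dist ⌈ m /2⌉ (2 ^ suc k) {{m^n≢0 2 (suc k)}}
    halves k = dist-halves {h = 2 ^ k} {{m^n≢0 2 (suc k)}} {{m^n≢0 2 (suc (suc k))}}
                 (2*n≡n+n (2 ^ k)) (2*n≡n+n (2 ^ suc k)) m

  Bfuel-distSum : ∀ f m → m ≤ f → ∀ K → m ≤ 2 ^ suc K → 2 * Bfuel f m + distSum K m ≡ m * suc K
  Bfuel-distSum zero          zero                _ K _ = distSum-small K z≤n
  Bfuel-distSum (suc f)       zero                _ K _ = distSum-small K z≤n
  Bfuel-distSum (suc f)       (suc zero)          _ K _ = distSum-small K ≤-refl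
  Bfuel-distSum (suc zero)    (suc (suc j))       (s≤s ()) _ _
  Bfuel-distSum (suc (suc f)) (suc (suc zero))    _ zero _ = refl
  Bfuel-distSum (suc f)       (suc (suc (suc j))) _ zero (s≤s (s≤s ()))
  Bfuel-distSum (suc f) m@(suc (suc j)) (s≤s m≤1+f) (suc K) m≤2^[2+K] = begin
    2 * (a + Bfuel f a + Bfuel f b) + distSum (suc K) m
      ≡⟨ cong (2 * (a + Bfuel f a + Bfuel f b) +_) (distSum-suc K m) ⟩
    2 * (a + Bfuel f a + Bfuel f b) + (dist m 2 + (distSum K a + distSum K b))
      ≡⟨ regroup a (Bfuel f a) (Bfuel f b) (dist m 2) (distSum K a) (distSum K b) ⟩
    (dist m 2 + a) + a + ((2 * Bfuel f a + distSum K a) + (2 * Bfuel f b + distSum K b))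
      ≡⟨ cong₂ (λ x y → x + a + y) (dist-2 m)
               (cong₂ _+_ (Bfuel-distSum f a a≤f K a≤2^[1+K]) (Bfuel-distSum f b b≤f K b≤2^[1+K])) ⟩
    b + a + (a * suc K + b * suc K)
      ≡⟨ collect a b K ⟩
    (a + b) * suc (suc K)
      ≡⟨ cong (_* suc (suc K)) (⌊n/2⌋+⌈n/2⌉≡n m) ⟩
    m * suc (suc K)
      ∎
    where
    a b : ℕ
    a = ⌊ m /2⌋
    b = ⌈ m /2⌉
    regroup : ∀ a Ba Bb d Sa Sb →
              2 * (a + Ba + Bb) + (d + (Sa + Sb)) ≡ (d + a) + a + ((2 * Ba + Sa) + (2 * Bb + Sb))
    regroup = solve-∀
    collect : ∀ a b K → b + a + (a * suc K + b * suc K) ≡ (a + b) * suc (suc K)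
    collect = solve-∀
    a≤f : a ≤ f
    a≤f = ≤-trans (s≤s⁻¹ (⌊n/2⌋<n (suc j))) m≤1+f
    b≤f : b ≤ f
    b≤f = ≤-trans (s≤s⁻¹ (⌈n/2⌉<n j)) m≤1+f
    b≤2^[1+K] : b ≤ 2 ^ suc K
    b≤2^[1+K] = ≤-trans (⌈n/2⌉-mono m≤2^[2+K])
                  (≤-reflexive (trans (cong ⌈_/2⌉ (2*n≡n+n (2 ^ suc K))) (sym (n≡⌈n+n/2⌉ (2 ^ suc K)))))
    a≤2^[1+K] : a ≤ 2 ^ suc K
    a≤2^[1+K] = ≤-trans (⌊n/2⌋≤⌈n/2⌉ m) b≤2^[1+K]

  n<2^[1+⌊log₂n⌋] : ∀ n → n < 2 ^ suc ⌊log₂ n ⌋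
  n<2^[1+⌊log₂n⌋] n = ≰⇒> λ 2^[1+L]≤n →
    1+n≰n (subst (_≤ ⌊log₂ n ⌋) (⌊log₂[2^n]⌋≡n (suc ⌊log₂ n ⌋)) (⌊log₂⌋-mono-≤ 2^[1+L]≤n))

  B-distSum : ∀ n → 2 * B n + distSum ⌊log₂ n ⌋ n ≡ n * suc ⌊log₂ n ⌋
  B-distSum n = Bfuel-distSum n n ≤-refl ⌊log₂ n ⌋ (<⇒≤ (n<2^[1+⌊log₂n⌋] n))

module Fraction where
  open import Data.Nat as ℕ using (ℕ; zero; suc; NonZero)
  import Data.Nat.Properties as ℕₚ
  import Data.Nat.DivMod as ℕ
  open import Data.Integer as ℤ using (ℤ; +_; -[1+_])
  import Data.Integer.Properties as ℤₚ
  open import Data.Integer.GCD using (gcd)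
  open import Data.Rational
    using (ℚ; mkℚ; ↥_; ↧_; ↧ₙ_; _/_; _+_; _*_; -_; _-_; _⊓_; _≤_; *≤*; *≡*; floor; ceiling; NonNegative)
  open import Data.Rational.Properties
    using (↥-/; ↧-/; ≃⇒≡; ↥-neg; ↧-neg; p≤q⇒p⊓q≡p; p≥q⇒p⊓q≡q; normalize-nonNeg)
  open import Data.Nat.Coprimality using (Coprime)
  open import Data.Sum using (inj₁; inj₂)
  open import Relation.Nullary using (contradiction; yes; no)
  open import Relation.Binary.PropositionalEquality
  open import Algebra.Properties.CommutativeSemigroup ℤₚ.*-commutativeSemigroup
    using (x∙yz≈xz∙y; xy∙z≈xz∙y; xy∙z≈x∙zy) renaming (interchange to *-interchange)
  open import Data.Integer.Tactic.RingSolver using (solve-∀)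
  open ≡-Reasoning
  open Distance using (tent; dist)
  open EqualFractions using (cross-/; cross-%)

  pos-∸ : ∀ {m n} → n ℕ.≤ m → + m ℤ.- + n ≡ + (m ℕ.∸ n)
  pos-∸ {m} {n} n≤m = trans (ℤₚ.m-n≡m⊖n m n) (ℤₚ.⊖-≥ n≤m)

  -- p = i / n, stated by cross-multiplication so that i and n need not be coprime.
  record IsFraction (p : ℚ) (i : ℤ) (n : ℕ) : Set where
    constructor mkIsFraction
    field cross : ↥ p ℤ.* + n ≡ i ℤ.* ↧ p

  /-isFraction : ∀ i n .{{_ : NonZero n}} → IsFraction (i / n) i n
  /-isFraction i n = mkIsFraction (begin
    ↥ (i / n) ℤ.* + n                 ≡⟨ cong (↥ (i / n) ℤ.*_) (↧-/ i n) ⟨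
    ↥ (i / n) ℤ.* (↧ (i / n) ℤ.* g)   ≡⟨ x∙yz≈xz∙y (↥ (i / n)) (↧ (i / n)) g ⟩
    ↥ (i / n) ℤ.* g ℤ.* ↧ (i / n)     ≡⟨ cong (ℤ._* ↧ (i / n)) (↥-/ i n) ⟩
    i ℤ.* ↧ (i / n)                   ∎)
    where
    g : ℤ
    g = gcd i (+ n)

  isFraction-rescale : ∀ {p i j n k} .{{_ : NonZero n}} →
                       IsFraction p i n → i ℤ.* + k ≡ j ℤ.* + n → IsFraction p j k
  isFraction-rescale {p} {i} {j} {n} {k} (mkIsFraction eq) i*k≡j*n =
    mkIsFraction (ℤₚ.*-cancelʳ-≡ _ _ (+ n) (begin
      ↥ p ℤ.* + k ℤ.* + n ≡⟨ xy∙z≈xz∙y (↥ p) (+ k) (+ n) ⟩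
      ↥ p ℤ.* + n ℤ.* + k ≡⟨ cong (ℤ._* + k) eq ⟩
      i ℤ.* ↧ p ℤ.* + k   ≡⟨ xy∙z≈xz∙y i (↧ p) (+ k) ⟩
      i ℤ.* + k ℤ.* ↧ p   ≡⟨ cong (ℤ._* ↧ p) i*k≡j*n ⟩
      j ℤ.* + n ℤ.* ↧ p   ≡⟨ xy∙z≈xz∙y j (+ n) (↧ p) ⟩
      j ℤ.* ↧ p ℤ.* + n   ∎))

  isFraction-unique : ∀ {p q i n} .{{_ : NonZero n}} → IsFraction p i n → IsFraction q i n → p ≡ q
  isFraction-unique {p} {q} {i} {n} (mkIsFraction p-eq) (mkIsFraction q-eq) =
    ≃⇒≡ (*≡* (ℤₚ.*-cancelʳ-≡ _ _ (+ n) (begin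
      ↥ p ℤ.* ↧ q ℤ.* + n ≡⟨ xy∙z≈xz∙y (↥ p) (↧ q) (+ n) ⟩
      ↥ p ℤ.* + n ℤ.* ↧ q ≡⟨ cong (ℤ._* ↧ q) p-eq ⟩
      i ℤ.* ↧ p ℤ.* ↧ q   ≡⟨ xy∙z≈xz∙y i (↧ p) (↧ q) ⟩
      i ℤ.* ↧ q ℤ.* ↧ p   ≡⟨ cong (ℤ._* ↧ p) q-eq ⟨
      ↥ q ℤ.* + n ℤ.* ↧ p ≡⟨ xy∙z≈xz∙y (↥ q) (+ n) (↧ p) ⟩
      ↥ q ℤ.* ↧ p ℤ.* + n ∎)))

  isFraction-neg : ∀ {p i n} → IsFraction p i n → IsFraction (- p) (ℤ.- i) n
  isFraction-neg {p} {i} {n} (mkIsFraction eq) = mkIsFraction (begin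
    ↥ (- p) ℤ.* + n     ≡⟨ cong (ℤ._* + n) (↥-neg p) ⟩
    ℤ.- ↥ p ℤ.* + n     ≡⟨ ℤₚ.neg-distribˡ-* (↥ p) (+ n) ⟨
    ℤ.- (↥ p ℤ.* + n)   ≡⟨ cong ℤ.-_ eq ⟩
    ℤ.- (i ℤ.* ↧ p)     ≡⟨ ℤₚ.neg-distribˡ-* i (↧ p) ⟩
    ℤ.- i ℤ.* ↧ p       ≡⟨ cong (ℤ.- i ℤ.*_) (↧-neg p) ⟨
    ℤ.- i ℤ.* ↧ (- p)   ∎)

  isFraction-+ : ∀ {p q i j n} .{{_ : NonZero n}} →
                 IsFraction p i n → IsFraction q j n → IsFraction (p + q) (i ℤ.+ j) n
  isFraction-+ {p@record{}} {q@record{}} {i} {j} {n} (mkIsFraction p-eq) (mkIsFraction q-eq) =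
    isFraction-rescale (/-isFraction (↥ p ℤ.* ↧ q ℤ.+ ↥ q ℤ.* ↧ p) (↧ₙ p ℕ.* ↧ₙ q)) (begin
      (↥ p ℤ.* ↧ q ℤ.+ ↥ q ℤ.* ↧ p) ℤ.* + n
        ≡⟨ spread (↥ p) (↥ q) (↧ p) (↧ q) (+ n) ⟩
      ↥ p ℤ.* + n ℤ.* ↧ q ℤ.+ ↥ q ℤ.* + n ℤ.* ↧ p
        ≡⟨ cong₂ (λ x y → x ℤ.* ↧ q ℤ.+ y ℤ.* ↧ p) p-eq q-eq ⟩
      i ℤ.* ↧ p ℤ.* ↧ q ℤ.+ j ℤ.* ↧ q ℤ.* ↧ p
        ≡⟨ collect i j (↧ p) (↧ q) ⟩
      (i ℤ.+ j) ℤ.* (↧ p ℤ.* ↧ q)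
        ≡⟨ cong ((i ℤ.+ j) ℤ.*_) (ℤₚ.pos-* (↧ₙ p) (↧ₙ q)) ⟨
      (i ℤ.+ j) ℤ.* + (↧ₙ p ℕ.* ↧ₙ q)
        ∎)
    where
    spread : ∀ a b d e n → (a ℤ.* e ℤ.+ b ℤ.* d) ℤ.* n ≡ a ℤ.* n ℤ.* e ℤ.+ b ℤ.* n ℤ.* d
    spread = solve-∀
    collect : ∀ i j d e → i ℤ.* d ℤ.* e ℤ.+ j ℤ.* e ℤ.* d ≡ (i ℤ.+ j) ℤ.* (d ℤ.* e)
    collect = solve-∀

  isFraction-minus : ∀ {p q i j n} .{{_ : NonZero n}} →
                 IsFraction p i n → IsFraction q j n → IsFraction (p - q) (i ℤ.- j) n
  isFraction-minus p-frac q-frac = isFraction-+ p-frac (isFraction-neg q-frac)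

  isFraction-* : ∀ {p q i j n k} .{{_ : NonZero n}} .{{_ : NonZero k}} →
                 IsFraction p i n → IsFraction q j k → IsFraction (p * q) (i ℤ.* j) (n ℕ.* k)
  isFraction-* {p@record{}} {q@record{}} {i} {j} {n} {k} (mkIsFraction p-eq) (mkIsFraction q-eq) =
    isFraction-rescale (/-isFraction (↥ p ℤ.* ↥ q) (↧ₙ p ℕ.* ↧ₙ q)) (begin
      ↥ p ℤ.* ↥ q ℤ.* + (n ℕ.* k)           ≡⟨ cong (↥ p ℤ.* ↥ q ℤ.*_) (ℤₚ.pos-* n k) ⟩
      ↥ p ℤ.* ↥ q ℤ.* (+ n ℤ.* + k)         ≡⟨ *-interchange (↥ p) (↥ q) (+ n) (+ k) ⟩
      ↥ p ℤ.* + n ℤ.* (↥ q ℤ.* + k)         ≡⟨ cong₂ ℤ._*_ p-eq q-eq ⟩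
      i ℤ.* ↧ p ℤ.* (j ℤ.* ↧ q)             ≡⟨ *-interchange i (↧ p) j (↧ q) ⟩
      i ℤ.* j ℤ.* (↧ p ℤ.* ↧ q)             ≡⟨ cong (i ℤ.* j ℤ.*_) (ℤₚ.pos-* (↧ₙ p) (↧ₙ q)) ⟨
      i ℤ.* j ℤ.* + (↧ₙ p ℕ.* ↧ₙ q)         ∎)

  isFraction-≤ : ∀ {p q a b n} .{{_ : NonZero n}} →
                 IsFraction p (+ a) n → IsFraction q (+ b) n → a ℕ.≤ b → p ≤ q
  isFraction-≤ {p} {q} {a} {b} {n} (mkIsFraction p-eq) (mkIsFraction q-eq) a≤b =
    *≤* (ℤₚ.*-cancelʳ-≤-pos _ _ (+ n) {{ℤ.positive (ℤ.+<+ (ℕ.>-nonZero⁻¹ n))}}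
          (subst₂ ℤ._≤_ (sym p-side) (sym q-side) (ℤₚ.*-monoʳ-≤-nonNeg (↧ p ℤ.* ↧ q) (ℤ.+≤+ a≤b))))
    where
    p-side : ↥ p ℤ.* ↧ q ℤ.* + n ≡ + a ℤ.* (↧ p ℤ.* ↧ q)
    p-side = trans (xy∙z≈xz∙y (↥ p) (↧ q) (+ n))
                   (trans (cong (ℤ._* ↧ q) p-eq) (ℤₚ.*-assoc (+ a) (↧ p) (↧ q)))
    q-side : ↥ q ℤ.* ↧ p ℤ.* + n ≡ + b ℤ.* (↧ p ℤ.* ↧ q)
    q-side = trans (xy∙z≈xz∙y (↥ q) (↧ p) (+ n))
                   (trans (cong (ℤ._* ↧ p) q-eq) (xy∙z≈x∙zy (+ b) (↧ q) (↧ p)))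

  isFraction-⊓ : ∀ {p q a b n} .{{_ : NonZero n}} →
                 IsFraction p (+ a) n → IsFraction q (+ b) n → IsFraction (p ⊓ q) (+ (a ℕ.⊓ b)) n
  isFraction-⊓ {a = a} {b} {n} p-frac q-frac with ℕₚ.≤-total a b
  ... | inj₁ a≤b = subst₂ (λ r c → IsFraction r (+ c) n)
                          (sym (p≤q⇒p⊓q≡p (isFraction-≤ p-frac q-frac a≤b))) (sym (ℕₚ.m≤n⇒m⊓n≡m a≤b)) p-frac
  ... | inj₂ b≤a = subst₂ (λ r c → IsFraction r (+ c) n)
                          (sym (p≥q⇒p⊓q≡q (isFraction-≤ q-frac p-frac b≤a))) (sym (ℕₚ.m≥n⇒m⊓n≡n b≤a)) q-frac

  ℤtoℚ-isFraction : ∀ j M .{{_ : NonZero M}} → IsFraction (ℤtoℚ j) (j ℤ.* + M) M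
  ℤtoℚ-isFraction j M = isFraction-rescale (/-isFraction j 1) (sym (ℤₚ.*-identityʳ (j ℤ.* + M)))

  floor-mkℚ : ∀ a d .(c : Coprime a (suc d)) → floor (mkℚ (+ a) d c) ≡ + (a ℕ./ suc d)
  floor-mkℚ a d c = ℤₚ.*-identityˡ (+ (a ℕ./ suc d))

  ceiling-mkℚ-∣ : ∀ a d .(c : Coprime a (suc d)) → a ℕ.% suc d ≡ 0 →
                  ceiling (mkℚ (+ a) d c) ≡ + (a ℕ./ suc d)
  ceiling-mkℚ-∣ zero    d c _ = refl
  ceiling-mkℚ-∣ (suc a) d c a%b≡0 with suc a ℕ.% suc d
  ... | zero  = trans (cong ℤ.-_ (ℤₚ.*-identityˡ _)) (ℤₚ.neg-involutive _)
  ... | suc _ = contradiction a%b≡0 λ ()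

  ceiling-mkℚ-∤ : ∀ a d .(c : Coprime a (suc d)) → a ℕ.% suc d ≢ 0 →
                  ceiling (mkℚ (+ a) d c) ≡ + suc (a ℕ./ suc d)
  ceiling-mkℚ-∤ zero    d c a%b≢0 = contradiction refl a%b≢0
  ceiling-mkℚ-∤ (suc a) d c a%b≢0 with suc a ℕ.% suc d
  ... | zero  = contradiction refl a%b≢0
  ... | suc _ = cong ℤ.-_ (ℤₚ.*-identityˡ -[1+ suc a ℕ./ suc d ])

  module _ {m M : ℕ} .{{_ : NonZero M}} where
    private
      r q : ℕ
      r = m ℕ.% M
      q = m ℕ./ M

      m≡r+q*M : + m ≡ + r ℤ.+ + q ℤ.* + M
      m≡r+q*M = trans (cong +_ (ℕ.m≡m%n+[m/n]*n m M))
                      (trans (ℤₚ.pos-+ r (q ℕ.* M)) (cong (λ x → + r ℤ.+ x) (ℤₚ.pos-* q M)))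

      cross-ℕ : ∀ {a d} .{c : Coprime a (suc d)} → IsFraction (mkℚ (+ a) d c) (+ m) M →
                a ℕ.* M ≡ m ℕ.* suc d
      cross-ℕ {a} {d} (mkIsFraction eq) =
        ℤₚ.+-injective (trans (ℤₚ.pos-* a M) (trans eq (sym (ℤₚ.pos-* m (suc d)))))

    floor-isFraction : ∀ {p} → NonNegative p → IsFraction p (+ m) M → floor p ≡ + q
    floor-isFraction {mkℚ (+ a) d c} _ p-frac =
      trans (floor-mkℚ a d c) (cong +_ (cross-/ (suc d) M {a} (cross-ℕ p-frac)))

    ceiling-isFraction-∣ : ∀ {p} → NonNegative p → IsFraction p (+ m) M → r ≡ 0 → ceiling p ≡ + q
    ceiling-isFraction-∣ {mkℚ (+ a) d c} _ p-frac r≡0 =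
      trans (ceiling-mkℚ-∣ a d c a%b≡0) (cong +_ (cross-/ (suc d) M {a} (cross-ℕ p-frac)))
      where
      a%b≡0 : a ℕ.% suc d ≡ 0
      a%b≡0 = ℕₚ.m*n≡0⇒m≡0 _ M (trans (cross-% (suc d) M {a} (cross-ℕ p-frac)) (cong (ℕ._* suc d) r≡0))

    ceiling-isFraction-∤ : ∀ {p} → NonNegative p → IsFraction p (+ m) M → r ≢ 0 → ceiling p ≡ + suc q
    ceiling-isFraction-∤ {mkℚ (+ a) d c} _ p-frac r≢0 =
      trans (ceiling-mkℚ-∤ a d c a%b≢0) (cong (λ x → + suc x) (cross-/ (suc d) M {a} (cross-ℕ p-frac)))
      where
      a%b≢0 : a ℕ.% suc d ≢ 0
      a%b≢0 a%b≡0 = r≢0 (ℕₚ.m*n≡0⇒m≡0 r (suc d)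
        (trans (sym (cross-% (suc d) M {a} (cross-ℕ p-frac))) (cong (ℕ._* M) a%b≡0)))

    fractional-isFraction : ∀ {p} → NonNegative p → IsFraction p (+ m) M →
                            IsFraction (p - ℤtoℚ (floor p)) (+ r) M
    fractional-isFraction {p} p≥0 p-frac =
      subst (λ i → IsFraction (p - ℤtoℚ (floor p)) i M) numerator
            (isFraction-minus p-frac (ℤtoℚ-isFraction (floor p) M))
      where
      cancel : ∀ x y → x ℤ.+ y ℤ.- y ≡ x
      cancel = solve-∀
      numerator : + m ℤ.- floor p ℤ.* + M ≡ + r
      numerator = begin
        + m ℤ.- floor p ℤ.* + M             ≡⟨ cong₂ (λ x y → x ℤ.- y ℤ.* + M)
                                                     m≡r+q*M (floor-isFraction p≥0 p-frac) ⟩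
        + r ℤ.+ + q ℤ.* + M ℤ.- + q ℤ.* + M ≡⟨ cancel (+ r) (+ q ℤ.* + M) ⟩
        + r                                 ∎

    ceilingGap-isFraction-∣ : ∀ {p} → NonNegative p → IsFraction p (+ m) M → r ≡ 0 →
                              IsFraction (ℤtoℚ (ceiling p) - p) (+ 0) M
    ceilingGap-isFraction-∣ {p} p≥0 p-frac r≡0 =
      subst (λ i → IsFraction (ℤtoℚ (ceiling p) - p) i M) numerator
            (isFraction-minus (ℤtoℚ-isFraction (ceiling p) M) p-frac)
      where
      cancel : ∀ x y → y ℤ.- (x ℤ.+ y) ≡ ℤ.- x
      cancel = solve-∀
      numerator : ceiling p ℤ.* + M ℤ.- + m ≡ + 0
      numerator = begin
        ceiling p ℤ.* + M ℤ.- + m             ≡⟨ cong₂ (λ x y → x ℤ.* + M ℤ.- y)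
                                                       (ceiling-isFraction-∣ p≥0 p-frac r≡0) m≡r+q*M ⟩
        + q ℤ.* + M ℤ.- (+ r ℤ.+ + q ℤ.* + M) ≡⟨ cancel (+ r) (+ q ℤ.* + M) ⟩
        ℤ.- + r                               ≡⟨ cong (λ x → ℤ.- + x) r≡0 ⟩
        + 0                                   ∎

    ceilingGap-isFraction-∤ : ∀ {p} → NonNegative p → IsFraction p (+ m) M → r ≢ 0 →
                              IsFraction (ℤtoℚ (ceiling p) - p) (+ (M ℕ.∸ r)) M
    ceilingGap-isFraction-∤ {p} p≥0 p-frac r≢0 =
      subst (λ i → IsFraction (ℤtoℚ (ceiling p) - p) i M) numerator
            (isFraction-minus (ℤtoℚ-isFraction (ceiling p) M) p-frac)
      where
      cancel : ∀ x y z → (ℤ.1ℤ ℤ.+ y) ℤ.* z ℤ.- (x ℤ.+ y ℤ.* z) ≡ z ℤ.- x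
      cancel = solve-∀
      numerator : ceiling p ℤ.* + M ℤ.- + m ≡ + (M ℕ.∸ r)
      numerator = begin
        ceiling p ℤ.* + M ℤ.- + m                        ≡⟨ cong₂ (λ x y → x ℤ.* + M ℤ.- y)
                                                                  (ceiling-isFraction-∤ p≥0 p-frac r≢0) m≡r+q*M ⟩
        (ℤ.1ℤ ℤ.+ + q) ℤ.* + M ℤ.- (+ r ℤ.+ + q ℤ.* + M) ≡⟨ cancel (+ r) (+ q) (+ M) ⟩
        + M ℤ.- + r                                      ≡⟨ pos-∸ (ℕₚ.<⇒≤ (ℕ.m%n<n m M)) ⟩
        + (M ℕ.∸ r)                                      ∎

    Zigzag-isFraction : ∀ {p} → NonNegative p → IsFraction p (+ m) M → IsFraction (Zigzag p) (+ dist m M) M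
    Zigzag-isFraction {p} p≥0 p-frac with r ℕ.≟ 0
    ... | yes r≡0 = subst (λ x → IsFraction (Zigzag p) (+ x) M)
                          (trans (ℕₚ.⊓-zeroʳ r) (sym (cong (λ x → tent x M) r≡0)))
                          (isFraction-⊓ (fractional-isFraction p≥0 p-frac)
                                        (ceilingGap-isFraction-∣ p≥0 p-frac r≡0))
    ... | no r≢0  = isFraction-⊓ (fractional-isFraction p≥0 p-frac)
                                 (ceilingGap-isFraction-∤ p≥0 p-frac r≢0)

  Zigzag-/-isFraction : ∀ m M .{{_ : NonZero M}} → IsFraction (Zigzag (+ m / M)) (+ dist m M) M
  Zigzag-/-isFraction m M = Zigzag-isFraction (normalize-nonNeg m M) (/-isFraction (+ m) M)

open import Data.Nat using (ℕ; suc; _^_; _≤_)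
open import Data.Nat.Logarithm using (⌊log₂_⌋)
open import Data.Integer using (+_)
open import Data.Rational using (ℚ; _/_; _*_; _-_)
open import Relation.Binary.PropositionalEquality using (_≡_)
open Distance using (dist)
open MergeSortCost using (distSum; B-distSum)
open Fraction
import Data.Nat as ℕ
import Data.Nat.Properties as ℕₚ
import Data.Integer as ℤ
import Data.Integer.Properties as ℤₚ
open import Relation.Binary.PropositionalEquality using (sym; trans; cong; subst; module ≡-Reasoning)
open import Data.Nat.Tactic.RingSolver using (solve-∀)

zigzagTerm : ℕ → ℕ → ℚ
zigzagTerm n k = ((+ (2 ^ k)) / 1) * Zigzag (n /2^ suc k)

zigzagTerm-isFraction : ∀ n k → IsFraction (zigzagTerm n k) (+ dist n (2 ^ suc k) {{ℕₚ.m^n≢0 2 (suc k)}}) 2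
zigzagTerm-isFraction n k = isFraction-rescale {{ℕₚ.m*n≢0 1 (2 ^ suc k)}}
  (isFraction-* (/-isFraction (+ (2 ^ k)) 1) (Zigzag-/-isFraction n (2 ^ suc k)))
  (trans (sym (trans (ℤₚ.pos-* (2 ^ k ℕ.* d) 2) (cong (ℤ._* + 2) (ℤₚ.pos-* (2 ^ k) d))))
         (trans (cong +_ (regroup (2 ^ k) d)) (ℤₚ.pos-* d (1 ℕ.* 2 ^ suc k))))
  where
  instance
    2^[1+k]≢0 : ℕ.NonZero (2 ^ suc k)
    2^[1+k]≢0 = ℕₚ.m^n≢0 2 (suc k)
  d : ℕ
  d = dist n (2 ^ suc k)
  regroup : ∀ x d → x ℕ.* d ℕ.* 2 ≡ d ℕ.* (1 ℕ.* (2 ℕ.* x))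
  regroup = solve-∀

sumUpTo-zigzagTerm-isFraction : ∀ n L → IsFraction (sumUpTo L (zigzagTerm n)) (+ distSum L n) 2
sumUpTo-zigzagTerm-isFraction n ℕ.zero  = zigzagTerm-isFraction n 0
sumUpTo-zigzagTerm-isFraction n (suc L) =
  subst (λ i → IsFraction (sumUpTo (suc L) (zigzagTerm n)) i 2) (sym (ℤₚ.pos-+ (distSum L n) _))
    (isFraction-+ (sumUpTo-zigzagTerm-isFraction n L) (zigzagTerm-isFraction n (suc L)))

corollary2p6 : (n : ℕ) → 1 ≤ n →
    (+ B n) / 1 ≡ (n /2^ 1) * ((+ suc ⌊log₂ n ⌋) / 1)
      - sumUpTo ⌊log₂ n ⌋ (λ k → ((+ (2 ^ k)) / 1) * Zigzag (n /2^ suc k))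
corollary2p6 n _ = isFraction-unique lhs (subst (λ i → IsFraction rhs-value i 2) numerator rhs)
  where
  L S : ℕ
  L = ⌊log₂ n ⌋
  S = distSum L n
  rhs-value : ℚ
  rhs-value = (n /2^ 1) * ((+ suc L) / 1) - sumUpTo L (zigzagTerm n)
  lhs : IsFraction ((+ B n) / 1) (+ (2 ℕ.* B n)) 2
  lhs = isFraction-rescale (/-isFraction (+ B n) 1)
    (trans (sym (ℤₚ.pos-* (B n) 2)) (trans (cong +_ (ℕₚ.*-comm (B n) 2)) (sym (ℤₚ.*-identityʳ _))))
  rhs : IsFraction rhs-value (+ n ℤ.* + suc L ℤ.- + S) 2
  rhs = isFraction-minus (isFraction-* (/-isFraction (+ n) 2) (/-isFraction (+ suc L) 1))
                     (sumUpTo-zigzagTerm-isFraction n L)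
  numerator : + n ℤ.* + suc L ℤ.- + S ≡ + (2 ℕ.* B n)
  numerator = begin
    + n ℤ.* + suc L ℤ.- + S        ≡⟨ cong (ℤ._- + S) (ℤₚ.pos-* n (suc L)) ⟨
    + (n ℕ.* suc L) ℤ.- + S        ≡⟨ cong (λ x → + x ℤ.- + S) (B-distSum n) ⟨
    + (2 ℕ.* B n ℕ.+ S) ℤ.- + S    ≡⟨ pos-∸ (ℕₚ.m≤n+m S (2 ℕ.* B n)) ⟩
    + (2 ℕ.* B n ℕ.+ S ℕ.∸ S)      ≡⟨ cong +_ (ℕₚ.m+n∸n≡m (2 ℕ.* B n) S) ⟩
    + (2 ℕ.* B n)                  ∎
    where open ≡-Reasoning
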